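{- Let $M=(\mathcal P_1\uplus\mathcal P_2,\mathcal R,m,f)$ be a DP problem. If $(\succsim,\succcurlyeq,\succ)$ is a reduction triple such that (1) $\ell\succsim r$ for all $\ell\Rightarrow r\in\mathcal R$; (2) $\ell\succ p$ for all $\ell\Rrightarrow p\ (A)\in\mathcal P_1$; (3) $\ell\succcurlyeq p$ for all $\ell\Rrightarrow p\ (A)\in\mathcal P_2$, then the processor that maps $M$ to $\{(\mathcal P_2,\mathcal R,m,f)\}$ (and every DP problem for which no such data is given to the singleton containing itself) is both sound and complete.
   Context: Basic notions (higher-order rewriting with meta-variables). Types are built from sorts by $\to$. There are disjoint sets of function symbols, variables $\mathcal V$ and meta-variables (each typed; meta-variables $Z$ have an arity; infinitely many variables and meta-variables of each type). Meta-terms are built from variables, function symbols, application $s\,t$, abstraction $\lambda x.s$ and meta-variable applications $Z\langle s_1,..,s_k\rangle$ ($k=\mathit{arity}(Z)$), all well-typed; terms are meta-terms without meta-variables; modulo $\alpha$; $FV,FMV$ = free variables, meta-variables; closed = no free variables. A pattern is $Z\langle x_1..x_k\rangle$ (distinct variables), $\lambda x.\ell$, or $a\,\ell_1\cdots\ell_n$ with $a$ a function symbol or variable. Substitutions map variables/meta-variables to (meta-)terms; $Z\langle s_1..s_k\rangle\gamma=u[x_1:=s_1\gamma..x_n:=s_n\gamma](s_{n+1}\gamma)\cdots(s_k\gamma)$ if $\gamma(Z)=\lambda x_1..x_n.u$ ($n=k$, or $n<k$ and $u$ not an abstraction), otherwise substitution is homomorphic and capture-avoiding. A rule is $\ell\Rightarrow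 r$ with $\ell,r$ closed meta-terms of the same type, $\ell$ a pattern $\mathsf f\,\ell_1\cdots\ell_n$, $FMV(r)\subseteq FMV(\ell)$. $\to_{\mathcal R}$ is the closure under all contexts of $\ell\delta\to r\delta$ ($\ell\Rightarrow r\in\mathcal R$, $\mathrm{dom}(\delta)=FMV(\ell)$) and $\beta$: $(\lambda x.s)t\to s[x:=t]$ (written $\to_\beta$). The signature used for terms contains marked symbols $\mathsf f^\sharp$, and for each type countably many symbols not used in the rules. Dependency pairs: a DP is a triple $\ell\Rrightarrow p\ (A)$ with $\ell$ a closed pattern $\mathsf f\,\ell_1\cdots\ell_k$, $p$ a closed meta-term $\mathsf g\,p_1\cdots p_n$, $A$ a set of conditions $Z:i$; conservative if $FMV(p)\subseteq FMV(\ell)$. $\gamma$ respects $A$ if for all $Z:i\in A$, $\gamma(Z)=\lambda x_1..x_j.t$ with $i>j$ or ($i\le j$ and $x_i\in FV(t)$). $s\trianglerighteq^\beta_A t$: $s=t$; or $s=\lambda x.u$, $u\trianglerighteq^\beta_A t$; or $s=(\lambda x.u)s_0\cdots s_n$ and some $s_i\trianglerighteq^\beta_At$ or $u[x:=s_0]s_1\cdots s_n\trianglerighteq^\beta_At$; or $s=a\,s_1\cdots s_n$ ($a$ function symbol or variable) and some $s_i\trianglerighteq^\beta_At$; or $s=Z\langle t_1..t_e\rangle s_1\cdots s_n$ and some $s_i\trianglerighteq^\beta_At$, or some $t_i\trianglerighteq^\beta_At$ with $(Z:i)\in A$. Chains: a $(\mathcal P,\mathcal R)$-chain is a finite or infinite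 sequence $[(\ell_0\Rrightarrow p_0(A_0),s_0,t_0),\dots]$ of DPs in $\mathcal P$ and terms such that for all $i$ some substitution $\gamma_i$ on domain $FMV(\ell_i)\cup FMV(p_i)$ respecting $A_i$ has $s_i=\ell_i\gamma_i,t_i=p_i\gamma_i$, and $t_i=\mathsf f\,u_1\cdots u_n$, $s_{i+1}=\mathsf f\,w_1\cdots w_n$ with $u_j\to^*_{\mathcal R}w_j$. Minimal: strict subterms of all $t_i$ are $\to_{\mathcal R}$-terminating. Computable: fix a sort quasi-ordering with well-founded strict part; for a type $\sigma_1\to..\to\sigma_m\to\kappa$ and sort $\iota$, $\iota\succeq_+\sigma$ iff $\iota\succeq\kappa$ and $\iota\succ_-\sigma_i$ for all $i$, $\iota\succ_-\sigma$ iff $\iota\succ\kappa$ and $\iota\succeq_+\sigma_i$ for all $i$; $\mathit{Acc}(\mathsf f)=\{i\mid\iota\succeq_+\sigma_i\}$ for $\mathsf f:\sigma_1\to..\to\sigma_m\to\iota$. For rules $\mathcal U$, an RC-set is a set $I$ of base-type terms, all $\to_{\mathcal U}$-terminating, closed under $\to_{\mathcal U}$, containing each $x\,s_1..s_n$ ($x\in\mathcal V$) or $(\lambda x.u)s_0..s_n$ whose reducts all lie in $I$; $I$-computable: base-type terms in $I$, and $s:\sigma\to\tau$ with $s\,t$ $I$-computable for all $I$-computable $t$. $\mathsf f\,s_1..s_m\rightsquigarrow_I s_i\,t_1..t_n$ if both sides have base type, $i\in\mathit{Acc}(\mathsf f)$, all $t_j$ $I$-computable. $C_{\mathcal U}$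 is an RC-set with $C_{\mathcal U}=\{s$ base type, terminating under $\to_{\mathcal U}\cup\rightsquigarrow_{C_{\mathcal U}}$, with $s\to^*_{\mathcal U}\mathsf f\,s_1..s_m$ implying $s_i$ $C_{\mathcal U}$-computable for $i\in\mathit{Acc}(\mathsf f)\}$. A chain is $\mathcal U$-computable if $\to_{\mathcal U}\supseteq\to_{\mathcal R}$ and for all $i$, $(\lambda x_1..x_n.v)\gamma_i$ is $C_{\mathcal U}$-computable whenever $p_i\trianglerighteq^\beta_Bv$, $\gamma_i$ respects $B$, $FV(v)=\{x_1..x_n\}$. Formative: a reduction $s\to^*_{\mathcal R}\ell\gamma$ is $\ell$-formative if inductively: $\ell$ is not fully extended linear (a meta-variable occurs twice, or $\ell$ has a sub-meta-term $\lambda x.C[Z\langle\vec s\rangle]$ with $x\notin\vec s$); or $\ell=Z\langle\vec x\rangle$ and $s=\ell\gamma$; or $s=a\,s_1..s_n$, $\ell=a\,\ell_1..\ell_n$ ($a$ a (marked) function symbol or variable) with $s_i\to^*\ell_i\gamma$ $\ell_i$-formative; or $s=\lambda x.s'$, $\ell=\lambda x.\ell'$, $s'\to^*\ell'\gamma$ $\ell'$-formative; or $s=(\lambda x.u)v\,w_1..w_n$ and $u[x:=v]w_1..w_n\to^*\ell\gamma$ $\ell$-formative; or $\ell$ is not a meta-variable application and there are a rule $\ell'\Rightarrow r'$, meta-variables $Z_1..Z_n$, $\delta$ with $s\to^*(\ell'Z_1..Z_n)\delta$ $(\ell'Z_1..Z_n)$-formative and $(r'Z_1..Z_n)\delta\to^*\ell\gamma$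 $\ell$-formative. A chain is formative if each $t_i\to^*_{\mathcal R}s_{i+1}$ is $\ell_{i+1}$-formative. DP problems: $(\mathcal P,\mathcal R,m,f)$ with $m\in\{\mathtt{minimal},\mathtt{arbitrary}\}\cup\{\mathtt{computable}_{\mathcal U}\}$, $f\in\{\mathtt{formative},\mathtt{all}\}$. Finite: no infinite $(\mathcal P,\mathcal R)$-chain that is $\mathcal U$-computable if $m=\mathtt{computable}_{\mathcal U}$, minimal if $m=\mathtt{minimal}$, formative if $f=\mathtt{formative}$. Infinite: $\to_{\mathcal R}$ non-terminating or an infinite $(\mathcal P,\mathcal R)$-chain with only conservative DPs exists. A processor maps a DP problem to NO or a set of DP problems; sound if $M$ is finite whenever $\mathit{Proc}(M)\ne$ NO and all its elements are finite; complete if $M$ is infinite whenever $\mathit{Proc}(M)=$ NO or contains an infinite element. Reduction triple: $(\succsim,\succcurlyeq,\succ)$ with $\succsim,\succcurlyeq$ quasi-orderings and $\succ$ a well-founded strict ordering on meta-terms, such that $\succsim$ is monotonic (closed under application contexts on either side and under $\lambda$), all three are meta-stable ($\ell\,R\,r$ implies $\ell\gamma\,R\,r\gamma$ whenever $\ell$ is a closed pattern and $\gamma$ a substitution on domain $FMV(\ell)\cup FMV(r)$), $\to_\beta\subseteq\succsim$, $\succsim\circ\succ\subseteq\succ$ and $\succcurlyeq\circ\succ\subseteq\succ$. -}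

module Defs where

open import Level using (0ℓ)
open import Data.Nat using (ℕ; zero; suc)
open import Data.List using (List; []; _∷_; _++_; [_])
open import Data.List.Relation.Unary.All using (All)
open import Data.List.Relation.Unary.Any using (Any)
open import Data.List.Membership.Propositional using (_∈_)
open import Data.List.Relation.Unary.Unique.Propositional using (Unique)
open import Data.Product using (Σ; _×_; _,_; ∃; proj₁; proj₂)
open import Data.Sum using (_⊎_)
open import Data.Unit using (⊤)
open import Data.Empty using (⊥)
open import Relation.Nullary using (¬_)
open import Relation.Binary.PropositionalEquality using (_≡_; refl; subst)
open import Relation.Binary.Construct.Closure.ReflexiveTransitive using (Star)
open import Induction.WellFounded using (Acc; WellFounded)
open import Relation.Binary.Core using (Rel)
open import Relation.Binary.Structures using (IsPreorder; IsStrictPartialOrder)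

data Nth {A : Set} : List A → ℕ → A → Set where
  nZ : ∀ {x xs} → Nth (x ∷ xs) zero x
  nS : ∀ {x y xs k} → Nth xs k y → Nth (x ∷ xs) (suc k) y

data Dup {A : Set} : List A → Set where
  dupH : ∀ {x xs} → x ∈ xs → Dup (x ∷ xs)
  dupT : ∀ {x xs} → Dup xs → Dup (x ∷ xs)

data Ty (S : Set) : Set where
  base : S → Ty S
  _⇒_  : Ty S → Ty S → Ty S

infixr 30 _⇒_

-- A signature: sorts, function symbols (including marked ones) with types
record Signature : Set₁ where
  field
    Sort  : Set
    Fun   : Set
    funTy : Fun → Ty Sort

-- The whole development, for a fixed signature and a fixed
-- sort quasi-ordering _≽ₛ_ (used only for computability).

module Theory (Sg : Signature) (_≽ₛ_ : Signature.Sort Sg → Signature.Sort Sg → Set) where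
  open Signature Sg

  Type : Set
  Type = Ty Sort

  _⇛_ : List Type → Type → Type
  [] ⇛ τ = τ
  (σ ∷ σs) ⇛ τ = σ ⇒ (σs ⇛ τ)

  Ctx : Set
  Ctx = List Type

  data _∋_ : Ctx → Type → Set where
    here  : ∀ {Γ σ} → (σ ∷ Γ) ∋ σ
    there : ∀ {Γ σ τ} → Γ ∋ σ → (τ ∷ Γ) ∋ σ

  -- Bound variables are de Bruijn indices (so
  -- alpha-equivalence is syntactic equality); free variables are named
  -- (a variable is a pair of a name n : ℕ and a type); a meta-variable
  -- is a triple (name, argument types σs, output type τ): it has type
  -- σs ⇛ τ and arity length σs.
  mutual
    data Tm (Γ : Ctx) : Type → Set where
      var  : ∀ {σ} → Γ ∋ σ → Tm Γ σ
      fvar : ∀ {σ} → ℕ → Tm Γ σ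
      fun  : (f : Fun) → Tm Γ (funTy f)
      app  : ∀ {σ τ} → Tm Γ (σ ⇒ τ) → Tm Γ σ → Tm Γ τ
      lam  : ∀ {σ τ} → Tm (σ ∷ Γ) τ → Tm Γ (σ ⇒ τ)
      meta : ∀ {σs τ} → ℕ → Args Γ σs → Tm Γ τ

    data Args (Γ : Ctx) : List Type → Set where
      []  : Args Γ []
      _∷_ : ∀ {σ σs} → Tm Γ σ → Args Γ σs → Args Γ (σ ∷ σs)

  Var : Set
  Var = ℕ × Type

  MVar : Set
  MVar = ℕ × List Type × Type

  TmL : Ctx → Set
  TmL Γ = List (Σ Type (Tm Γ))

  argsToList : ∀ {Γ σs} → Args Γ σs → TmL Γ
  argsToList [] = []
  argsToList (_∷_ {σ} t ts) = (σ , t) ∷ argsToList ts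

  Ren : Ctx → Ctx → Set
  Ren Γ Δ = ∀ {σ} → Γ ∋ σ → Δ ∋ σ

  liftR : ∀ {Γ Δ σ} → Ren Γ Δ → Ren (σ ∷ Γ) (σ ∷ Δ)
  liftR ρ here = here
  liftR ρ (there v) = there (ρ v)

  mutual
    ren : ∀ {Γ Δ σ} → Ren Γ Δ → Tm Γ σ → Tm Δ σ
    ren ρ (var v) = var (ρ v)
    ren ρ (fvar x) = fvar x
    ren ρ (fun f) = fun f
    ren ρ (app s t) = app (ren ρ s) (ren ρ t)
    ren ρ (lam s) = lam (ren (liftR ρ) s)
    ren ρ (meta Z ts) = meta Z (renA ρ ts)

    renA : ∀ {Γ Δ σs} → Ren Γ Δ → Args Γ σs → Args Δ σs
    renA ρ [] = []
    renA ρ (t ∷ ts) = ren ρ t ∷ renA ρ ts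

  wk : ∀ {Γ σ τ} → Tm Γ σ → Tm (τ ∷ Γ) σ
  wk = ren there

  Sub : Ctx → Ctx → Set
  Sub Γ Δ = ∀ {σ} → Γ ∋ σ → Tm Δ σ

  liftS : ∀ {Γ Δ σ} → Sub Γ Δ → Sub (σ ∷ Γ) (σ ∷ Δ)
  liftS θ here = var here
  liftS θ (there v) = wk (θ v)

  mutual
    sub : ∀ {Γ Δ σ} → Sub Γ Δ → Tm Γ σ → Tm Δ σ
    sub θ (var v) = θ v
    sub θ (fvar x) = fvar x
    sub θ (fun f) = fun f
    sub θ (app s t) = app (sub θ s) (sub θ t)
    sub θ (lam s) = lam (sub (liftS θ) s)
    sub θ (meta Z ts) = meta Z (subA θ ts)

    subA : ∀ {Γ Δ σs} → Sub Γ Δ → Args Γ σs → Args Δ σs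
    subA θ [] = []
    subA θ (t ∷ ts) = sub θ t ∷ subA θ ts

  _▸_ : ∀ {Γ Δ σ} → Sub Γ Δ → Tm Δ σ → Sub (σ ∷ Γ) Δ
  (θ ▸ t) here = t
  (θ ▸ t) (there v) = θ v

  idS : ∀ {Γ} → Sub Γ Γ
  idS v = var v

  emptyS : ∀ {Γ} → Sub [] Γ
  emptyS ()

  inst : ∀ {Γ σ τ} → Tm (σ ∷ Γ) τ → Tm Γ σ → Tm Γ τ
  inst u t = sub (idS ▸ t) u

  opn : ∀ {Γ σ τ} → Tm (σ ∷ Γ) τ → ℕ → Tm Γ τ
  opn {σ = σ} u x = inst u (fvar {σ = σ} x)

  apps : ∀ {Γ σs τ} → Tm Γ (σs ⇛ τ) → Args Γ σs → Tm Γ τ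
  apps t [] = t
  apps t (s ∷ ss) = apps (app t s) ss

  MSub : Set
  MSub = (Z : ℕ) (σs : List Type) (τ : Type) → Tm [] (σs ⇛ τ)

  -- Z⟨s1..sk⟩γ with γ(Z) = λx1..xn.u (n maximal, n ≤ k):
  --   u[x1:=s1γ..xn:=snγ] (s(n+1)γ) .. (skγ)
  mutual
    instM : ∀ {Δ Γ} σs τ → Tm Δ (σs ⇛ τ) → Sub Δ Γ → Args Γ σs → Tm Γ τ
    instM [] τ t θ [] = sub θ t
    instM (σ ∷ σs) τ t θ (s ∷ ss) = instC σs τ t refl θ s ss

    instC : ∀ {Δ Γ σ ρ} σs τ → Tm Δ ρ → ρ ≡ (σ ⇒ (σs ⇛ τ)) → Sub Δ Γ
          → Tm Γ σ → Args Γ σs → Tm Γ τ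
    instC σs τ (lam u) refl θ s ss = instM σs τ u (θ ▸ s) ss
    instC {Δ} σs τ t eq θ s ss = apps (app (sub θ (subst (Tm Δ) eq t)) s) ss

  mutual
    msub : ∀ {Γ σ} → MSub → Tm Γ σ → Tm Γ σ
    msub γ (var v) = var v
    msub γ (fvar x) = fvar x
    msub γ (fun f) = fun f
    msub γ (app s t) = app (msub γ s) (msub γ t)
    msub γ (lam s) = lam (msub γ s)
    msub γ (meta {σs} {τ} Z ts) = instM σs τ (γ Z σs τ) emptyS (msubA γ ts)

    msubA : ∀ {Γ σs} → MSub → Args Γ σs → Args Γ σs
    msubA γ [] = []
    msubA γ (t ∷ ts) = msub γ t ∷ msubA γ ts

  mutual
    data Occ (P : ∀ {Γ τ} → Tm Γ τ → Set) {Γ : Ctx} : ∀ {σ} → Tm Γ σ → Set where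
      occHere : ∀ {σ} {t : Tm Γ σ} → P t → Occ P t
      occAppL : ∀ {σ τ} {s : Tm Γ (σ ⇒ τ)} {t} → Occ P s → Occ P (app s t)
      occAppR : ∀ {σ τ} {s : Tm Γ (σ ⇒ τ)} {t} → Occ P t → Occ P (app s t)
      occLam  : ∀ {σ τ} {u : Tm (σ ∷ Γ) τ} → Occ P u → Occ P (lam u)
      occMeta : ∀ {σs τ Z} {ts : Args Γ σs} → OccA P ts → Occ P (meta {τ = τ} Z ts)

    data OccA (P : ∀ {Γ τ} → Tm Γ τ → Set) {Γ : Ctx} : ∀ {σs} → Args Γ σs → Set where
      occH : ∀ {σ σs} {t : Tm Γ σ} {ts : Args Γ σs} → Occ P t → OccA P (t ∷ ts)
      occT : ∀ {σ σs} {t : Tm Γ σ} {ts : Args Γ σs} → OccA P ts → OccA P (t ∷ ts)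

  data IsFV (x : ℕ) (σ : Type) : ∀ {Γ τ} → Tm Γ τ → Set where
    isFV : ∀ {Γ} → IsFV x σ (fvar {Γ} {σ} x)

  data IsMV : MVar → ∀ {Γ τ} → Tm Γ τ → Set where
    isMV : ∀ {Γ σs τ Z} {ts : Args Γ σs} → IsMV (Z , σs , τ) (meta {τ = τ} Z ts)

  data IsFun (f : Fun) : ∀ {Γ τ} → Tm Γ τ → Set where
    isFun : ∀ {Γ} → IsFun f (fun {Γ} f)

  OccF : ∀ {Γ τ} → ℕ → Type → Tm Γ τ → Set
  OccF x σ t = Occ (IsFV x σ) t

  OccM : ∀ {Γ τ} → MVar → Tm Γ τ → Set
  OccM Z t = Occ (IsMV Z) t

  OccFun : ∀ {Γ τ} → Fun → Tm Γ τ → Set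
  OccFun f t = Occ (IsFun f) t

  Closed : ∀ {Γ τ} → Tm Γ τ → Set
  Closed t = ∀ x σ → ¬ OccF x σ t

  -- a term = a meta-term without meta-variables
  NoMeta : ∀ {Γ τ} → Tm Γ τ → Set
  NoMeta t = ∀ Z → ¬ OccM Z t

  mutual
    data OccB : ∀ {Γ σ τ} → Γ ∋ σ → Tm Γ τ → Set where
      obVar  : ∀ {Γ σ} {v : Γ ∋ σ} → OccB v (var v)
      obAppL : ∀ {Γ σ α τ} {v : Γ ∋ σ} {s : Tm Γ (α ⇒ τ)} {t} → OccB v s → OccB v (app s t)
      obAppR : ∀ {Γ σ α τ} {v : Γ ∋ σ} {s : Tm Γ (α ⇒ τ)} {t} → OccB v t → OccB v (app s t)
      obLam  : ∀ {Γ σ α τ} {v : Γ ∋ σ} {u : Tm (α ∷ Γ) τ} → OccB (there v) u → OccB v (lam u)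
      obMeta : ∀ {Γ σ σs τ Z} {v : Γ ∋ σ} {ts : Args Γ σs} → OccBA v ts → OccB v (meta {τ = τ} Z ts)

    data OccBA : ∀ {Γ σ σs} → Γ ∋ σ → Args Γ σs → Set where
      obH : ∀ {Γ σ α αs} {v : Γ ∋ σ} {t : Tm Γ α} {ts : Args Γ αs} → OccB v t → OccBA v (t ∷ ts)
      obT : ∀ {Γ σ α αs} {v : Γ ∋ σ} {t : Tm Γ α} {ts : Args Γ αs} → OccBA v ts → OccBA v (t ∷ ts)

  mutual
    mvars : ∀ {Γ σ} → Tm Γ σ → List MVar
    mvars (var v) = []
    mvars (fvar x) = []
    mvars (fun f) = []
    mvars (app s t) = mvars s ++ mvars t
    mvars (lam s) = mvars s
    mvars (meta {σs} {τ} Z ts) = (Z , σs , τ) ∷ mvarsA ts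

    mvarsA : ∀ {Γ σs} → Args Γ σs → List MVar
    mvarsA [] = []
    mvarsA (t ∷ ts) = mvars t ++ mvarsA ts

  data NotLam {Γ : Ctx} : ∀ {σ} → Tm Γ σ → Set where
    nlVar  : ∀ {σ} {v : Γ ∋ σ} → NotLam (var v)
    nlFVar : ∀ {σ x} → NotLam (fvar {Γ} {σ} x)
    nlFun  : ∀ {f} → NotLam (fun f)
    nlApp  : ∀ {σ τ} {s : Tm Γ (σ ⇒ τ)} {t} → NotLam (app s t)
    nlMeta : ∀ {σs τ Z} {ts : Args Γ σs} → NotLam (meta {τ = τ} Z ts)

  data NotApp {Γ : Ctx} : ∀ {σ} → Tm Γ σ → Set where
    naVar  : ∀ {σ} {v : Γ ∋ σ} → NotApp (var v)
    naFVar : ∀ {σ x} → NotApp (fvar {Γ} {σ} x)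
    naFun  : ∀ {f} → NotApp (fun f)
    naLam  : ∀ {σ τ} {u : Tm (σ ∷ Γ) τ} → NotApp (lam u)
    naMeta : ∀ {σs τ Z} {ts : Args Γ σs} → NotApp (meta {τ = τ} Z ts)

  data NotMetaApp {Γ : Ctx} : ∀ {σ} → Tm Γ σ → Set where
    nmVar  : ∀ {σ} {v : Γ ∋ σ} → NotMetaApp (var v)
    nmFVar : ∀ {σ x} → NotMetaApp (fvar {Γ} {σ} x)
    nmFun  : ∀ {f} → NotMetaApp (fun f)
    nmApp  : ∀ {σ τ} {s : Tm Γ (σ ⇒ τ)} {t} → NotMetaApp (app s t)
    nmLam  : ∀ {σ τ} {u : Tm (σ ∷ Γ) τ} → NotMetaApp (lam u)

  data RigidHead {Γ : Ctx} : ∀ {σ} → Tm Γ σ → Set where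
    rhFun  : ∀ {f} → RigidHead (fun f)
    rhVar  : ∀ {σ} {v : Γ ∋ σ} → RigidHead (var v)
    rhFVar : ∀ {σ x} → RigidHead (fvar {Γ} {σ} x)

  data IsVarT {Γ : Ctx} : ∀ {σ} → Tm Γ σ → Set where
    ivB : ∀ {σ} {v : Γ ∋ σ} → IsVarT (var v)
    ivF : ∀ {σ x} → IsVarT (fvar {Γ} {σ} x)

  data AppList {Γ : Ctx} : ∀ {τ α} → Tm Γ τ → Tm Γ α → TmL Γ → Set where
    alNil  : ∀ {α} {h : Tm Γ α} → AppList h h []
    alSnoc : ∀ {α β τ} {t : Tm Γ (β ⇒ τ)} {h : Tm Γ α} {as u}
           → AppList t h as → AppList (app t u) h (as ++ [ (β , u) ])

  data HeadBeta {Γ : Ctx} : ∀ {τ} → Tm Γ τ → Tm Γ τ → Set where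
    hb0 : ∀ {σ τ} {u : Tm (σ ∷ Γ) τ} {v} → HeadBeta (app (lam u) v) (inst u v)
    hbS : ∀ {σ τ} {s s' : Tm Γ (σ ⇒ τ)} {w} → HeadBeta s s' → HeadBeta (app s w) (app s' w)

  data MetaPat {Γ : Ctx} : ∀ {σ} → Tm Γ σ → Set where
    mp : ∀ {σs τ Z} {ts : Args Γ σs}
       → All (λ p → IsVarT (proj₂ p)) (argsToList ts) → Unique (argsToList ts)
       → MetaPat (meta {τ = τ} Z ts)

  data Pat : ∀ {Γ σ} → Tm Γ σ → Set where
    pMeta : ∀ {Γ σ} {t : Tm Γ σ} → MetaPat t → Pat t
    pLam  : ∀ {Γ σ τ} {u : Tm (σ ∷ Γ) τ} → Pat u → Pat (lam u)
    pApp  : ∀ {Γ σ α} {s : Tm Γ σ} {h : Tm Γ α} {as}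
          → AppList s h as → RigidHead h → All (λ p → Pat (proj₂ p)) as → Pat s

  FunPat : ∀ {σ} → Tm [] σ → Set
  FunPat ℓ = Pat ℓ × Σ Fun (λ f → Σ (TmL []) (λ as → AppList ℓ (fun f) as))

  data VarIn {Γ σ} (v : Γ ∋ σ) : ∀ {σs} → Args Γ σs → Set where
    viH : ∀ {σs} {ts : Args Γ σs} → VarIn v (var v ∷ ts)
    viT : ∀ {α σs} {t : Tm Γ α} {ts : Args Γ σs} → VarIn v ts → VarIn v (t ∷ ts)

  mutual
    data Missing : ∀ {Γ σ τ} → Γ ∋ σ → Tm Γ τ → Set where
      msHere : ∀ {Γ σ σs τ Z} {v : Γ ∋ σ} {ts : Args Γ σs} → ¬ VarIn v ts → Missing v (meta {τ = τ} Z ts)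
      msArg  : ∀ {Γ σ σs τ Z} {v : Γ ∋ σ} {ts : Args Γ σs} → MissingA v ts → Missing v (meta {τ = τ} Z ts)
      msAppL : ∀ {Γ σ α τ} {v : Γ ∋ σ} {s : Tm Γ (α ⇒ τ)} {t} → Missing v s → Missing v (app s t)
      msAppR : ∀ {Γ σ α τ} {v : Γ ∋ σ} {s : Tm Γ (α ⇒ τ)} {t} → Missing v t → Missing v (app s t)
      msLam  : ∀ {Γ σ α τ} {v : Γ ∋ σ} {u : Tm (α ∷ Γ) τ} → Missing (there v) u → Missing v (lam u)

    data MissingA : ∀ {Γ σ σs} → Γ ∋ σ → Args Γ σs → Set where
      mH : ∀ {Γ σ α αs} {v : Γ ∋ σ} {t : Tm Γ α} {ts : Args Γ αs} → Missing v t → MissingA v (t ∷ ts)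
      mT : ∀ {Γ σ α αs} {v : Γ ∋ σ} {t : Tm Γ α} {ts : Args Γ αs} → MissingA v ts → MissingA v (t ∷ ts)

  data BadLam : ∀ {Γ τ} → Tm Γ τ → Set where
    badLam : ∀ {Γ σ τ} {u : Tm (σ ∷ Γ) τ} → Missing here u → BadLam (lam u)

  NotFEL : ∀ {Γ σ} → Tm Γ σ → Set
  NotFEL ℓ = Dup (mvars ℓ) ⊎ Occ BadLam ℓ

  record Rule : Set where
    constructor mkRule
    field
      {rty} : Type
      lhs   : Tm [] rty
      rhs   : Tm [] rty

  Rules : Set₁
  Rules = Rule → Set

  WFRule : Rule → Set
  WFRule ρ = Closed (Rule.lhs ρ) × FunPat (Rule.lhs ρ) × Closed (Rule.rhs ρ)
           × (∀ Z → OccM Z (Rule.rhs ρ) → OccM Z (Rule.lhs ρ))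

  WFRules : Rules → Set
  WFRules R = ∀ ρ → R ρ → WFRule ρ

  -- one rewrite step (rules or β), closed under all contexts;
  -- going under a binder opens it with a fresh variable
  mutual
    data Step (R : Rules) : ∀ {σ} → Tm [] σ → Tm [] σ → Set where
      root  : ∀ {ρ} → R ρ → (δ : MSub) → Step R (msub δ (Rule.lhs ρ)) (msub δ (Rule.rhs ρ))
      beta  : ∀ {σ τ} {u : Tm (σ ∷ []) τ} {v} → Step R (app (lam u) v) (inst u v)
      appL  : ∀ {σ τ} {s s' : Tm [] (σ ⇒ τ)} {t} → Step R s s' → Step R (app s t) (app s' t)
      appR  : ∀ {σ τ} {s : Tm [] (σ ⇒ τ)} {t t'} → Step R t t' → Step R (app s t) (app s t')
      abs   : ∀ {σ τ} {u u' : Tm (σ ∷ []) τ} (x : ℕ) → ¬ OccF x σ (lam u) → ¬ OccF x σ (lam u')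
            → Step R (opn u x) (opn u' x) → Step R (lam u) (lam u')
      metaA : ∀ {σs τ Z} {ts ts' : Args [] σs} → StepA R ts ts' → Step R (meta {τ = τ} Z ts) (meta Z ts')

    data StepA (R : Rules) : ∀ {σs} → Args [] σs → Args [] σs → Set where
      sH : ∀ {σ σs} {s s' : Tm [] σ} {ts : Args [] σs} → Step R s s' → StepA R (s ∷ ts) (s' ∷ ts)
      sT : ∀ {σ σs} {s : Tm [] σ} {ts ts' : Args [] σs} → StepA R ts ts' → StepA R (s ∷ ts) (s ∷ ts')

  NoRules : Rules
  NoRules _ = ⊥

  BetaStep : ∀ {σ} → Tm [] σ → Tm [] σ → Set
  BetaStep = Step NoRules

  Steps : Rules → ∀ {σ} → Tm [] σ → Tm [] σ → Set
  Steps R = Star (Step R)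

  SN : Rules → ∀ {σ} → Tm [] σ → Set
  SN R s = Acc (λ y x → Step R x y) s

  NonTerminating : Rules → Set
  NonTerminating R = Σ Type λ σ → Σ (ℕ → Tm [] σ) λ f →
                     (∀ i → NoMeta (f i)) × (∀ i → Step R (f i) (f (suc i)))

  FreshSymbols : Rules → Set
  FreshSymbols R = ∀ σ → Σ (ℕ → Fun) λ c →
      (∀ n → funTy (c n) ≡ σ) × (∀ n k → c n ≡ c k → n ≡ k)
    × (∀ n ρ → R ρ → ¬ OccFun (c n) (Rule.lhs ρ) × ¬ OccFun (c n) (Rule.rhs ρ))

  -- a condition Z : i ; the index is stored 0-based (i = k + 1)
  Cond : Set
  Cond = MVar × ℕ

  record DP : Set where
    constructor mkDP
    field
      {lty rty} : Type
      lhs   : Tm [] lty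
      rhs   : Tm [] rty
      conds : List Cond

  IsDP : DP → Set
  IsDP d = (Closed (DP.lhs d) × FunPat (DP.lhs d))
         × (Closed (DP.rhs d) × Σ Fun (λ g → Σ (TmL []) (λ as → AppList (DP.rhs d) (fun g) as)))

  Conservative : DP → Set
  Conservative d = ∀ Z → OccM Z (DP.rhs d) → OccM Z (DP.lhs d)

  data OccBody : ∀ {Γ σ τ} → Γ ∋ σ → Tm Γ τ → Set where
    obdLam  : ∀ {Γ σ α τ} {v : Γ ∋ σ} {b : Tm (α ∷ Γ) τ} → OccBody (there v) b → OccBody v (lam b)
    obdBody : ∀ {Γ σ τ} {v : Γ ∋ σ} {b : Tm Γ τ} → NotLam b → OccB v b → OccBody v b

  -- RespAt k w, for w = λx1..xj.t (j maximal) and i = k+1 :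
  --   i > j  or  (i ≤ j and x_i ∈ FV(t))
  data RespAt : ∀ {Γ τ} → ℕ → Tm Γ τ → Set where
    raNotLam : ∀ {Γ τ k} {w : Tm Γ τ} → NotLam w → RespAt k w
    raZero   : ∀ {Γ σ τ} {b : Tm (σ ∷ Γ) τ} → OccBody here b → RespAt zero (lam b)
    raSuc    : ∀ {Γ σ τ k} {b : Tm (σ ∷ Γ) τ} → RespAt k b → RespAt (suc k) (lam b)

  Respects : MSub → List Cond → Set
  Respects γ A = ∀ {Z σs τ k} → ((Z , σs , τ) , k) ∈ A → RespAt k (γ Z σs τ)

  data Sup (A : List Cond) {τ} (t : Tm [] τ) : ∀ {σ} → Tm [] σ → Set where
    supRefl : Sup A t t
    supLam  : ∀ {σ ρ} {u : Tm (σ ∷ []) ρ} (x : ℕ) → ¬ OccF x σ (lam u)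
            → Sup A t (opn u x) → Sup A t (lam u)
    supArg  : ∀ {σ α} {s : Tm [] σ} {h : Tm [] α} {as}
            → AppList s h as → NotApp h → Any (λ p → Sup A t (proj₂ p)) as → Sup A t s
    supBeta : ∀ {σ} {s s' : Tm [] σ} → HeadBeta s s' → Sup A t s' → Sup A t s
    supMeta : ∀ {σ σs ρ β Z k as} {s : Tm [] σ} {ts : Args [] σs} {u : Tm [] β}
            → AppList s (meta {τ = ρ} Z ts) as → ((Z , σs , ρ) , k) ∈ A
            → Nth (argsToList ts) k (β , u) → Sup A t u → Sup A t s

  _⊵β[_]_ : ∀ {σ τ} → Tm [] σ → List Cond → Tm [] τ → Set
  s ⊵β[ A ] t = Sup A t s

  data AbsOf {τ} (v : Tm [] τ) : List Var → ∀ {ρ} → Tm [] ρ → Set where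
    absNil  : AbsOf v [] v
    absCons : ∀ {xs x σ ρ} {w : Tm [] ρ} {c : Tm (σ ∷ []) ρ}
            → AbsOf v xs w → ¬ OccF x σ c → opn c x ≡ w → AbsOf v ((x , σ) ∷ xs) (lam c)

  data Link (R : Rules) : ∀ {σ} → Tm [] σ → Tm [] σ → Set where
    lkHead : ∀ {f} → Link R (fun f) (fun f)
    lkApp  : ∀ {σ τ} {t s : Tm [] (σ ⇒ τ)} {u w} → Link R t s → Steps R u w → Link R (app t u) (app s w)

  record Chain (P : DP → Set) (R : Rules) : Set where
    field
      dp    : ℕ → DP
      inP   : ∀ i → P (dp i)
      s     : ∀ i → Tm [] (DP.lty (dp i))
      t     : ∀ i → Tm [] (DP.rty (dp i))
      γ     : ℕ → MSub
      sTerm : ∀ i → NoMeta (s i)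
      tTerm : ∀ i → NoMeta (t i)
      resp  : ∀ i → Respects (γ i) (DP.conds (dp i))
      sEq   : ∀ i → s i ≡ msub (γ i) (DP.lhs (dp i))
      tEq   : ∀ i → t i ≡ msub (γ i) (DP.rhs (dp i))
      tyEq  : ∀ i → DP.rty (dp i) ≡ DP.lty (dp (suc i))
      link  : ∀ i → Link R (subst (Tm []) (tyEq i) (t i)) (s (suc i))

  data Imm : ∀ {σ τ} → Tm [] σ → Tm [] τ → Set where
    iAppL : ∀ {σ τ} {s : Tm [] (σ ⇒ τ)} {t} → Imm (app s t) s
    iAppR : ∀ {σ τ} {s : Tm [] (σ ⇒ τ)} {t} → Imm (app s t) t
    iLam  : ∀ {σ τ} {u : Tm (σ ∷ []) τ} (x : ℕ) → ¬ OccF x σ (lam u) → Imm (lam u) (opn u x)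
    iMeta : ∀ {σs τ β Z k} {ts : Args [] σs} {u : Tm [] β}
          → Nth (argsToList ts) k (β , u) → Imm (meta {τ = τ} Z ts) u

  data Below : ∀ {σ τ} → Tm [] σ → Tm [] τ → Set where
    bOne  : ∀ {σ τ} {t : Tm [] σ} {u : Tm [] τ} → Imm t u → Below t u
    bMore : ∀ {σ ρ τ} {t : Tm [] σ} {w : Tm [] ρ} {u : Tm [] τ} → Imm t w → Below w u → Below t u

  Minimal : ∀ {P R} → Chain P R → Set
  Minimal {R = R} c = ∀ i {σ} (u : Tm [] σ) → Below (Chain.t c i) u → SN R u

  -- formative reductions:  Form R s ℓ γ  means  "s →*R ℓγ is ℓ-formative"
  data Ext {Γ : Ctx} : ∀ {T σ} → Tm Γ T → Tm Γ σ → List MVar → Set where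
    extNil  : ∀ {T} {t : Tm Γ T} → Ext t t []
    extSnoc : ∀ {T β σ} {t : Tm Γ T} {u : Tm Γ (β ⇒ σ)} {Zs Z}
            → Ext t u Zs → Ext t (app u (meta {τ = β} Z [])) (Zs ++ [ (Z , [] , β) ])

  mutual
    data Form (R : Rules) : ∀ {σ} → Tm [] σ → Tm [] σ → MSub → Set where
      fNonFEL : ∀ {σ} {s ℓ : Tm [] σ} {γ} → NotFEL ℓ → Steps R s (msub γ ℓ) → Form R s ℓ γ
      fMeta   : ∀ {σ} {s ℓ : Tm [] σ} {γ} → MetaPat ℓ → s ≡ msub γ ℓ → Form R s ℓ γ
      fSpine  : ∀ {σ} {s ℓ : Tm [] σ} {γ} → FSpine R s ℓ γ → Form R s ℓ γ
      fLam    : ∀ {σ τ} {s' ℓ' : Tm (σ ∷ []) τ} {γ} (x : ℕ)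
              → ¬ OccF x σ (lam s') → ¬ OccF x σ (msub γ (lam ℓ'))
              → Form R (opn s' x) (opn ℓ' x) γ → Form R (lam s') (lam ℓ') γ
      fBeta   : ∀ {σ} {s s' ℓ : Tm [] σ} {γ} → HeadBeta s s' → Form R s' ℓ γ → Form R s ℓ γ
      fRule   : ∀ {σ} {s ℓ L Rr : Tm [] σ} {γ ρ} (Zs : List MVar) (δ : MSub)
              → NotMetaApp ℓ → R ρ → Unique Zs → (∀ Z → Z ∈ Zs → ¬ OccM Z (Rule.lhs ρ))
              → Ext (Rule.lhs ρ) L Zs → Ext (Rule.rhs ρ) Rr Zs
              → Form R s L δ → Form R (msub δ Rr) ℓ γ → Form R s ℓ γ

    data FSpine (R : Rules) : ∀ {σ} → Tm [] σ → Tm [] σ → MSub → Set where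
      fsFun  : ∀ {f γ} → FSpine R (fun f) (fun f) γ
      fsFVar : ∀ {σ x γ} → FSpine R (fvar {σ = σ} x) (fvar x) γ
      fsApp  : ∀ {α σ} {s ℓ : Tm [] (α ⇒ σ)} {u l γ}
             → FSpine R s ℓ γ → Form R u l γ → FSpine R (app s u) (app ℓ l) γ

  Formative : ∀ {P R} → Chain P R → Set
  Formative {R = R} c = ∀ i →
    Form R (subst (Tm []) (Chain.tyEq c i) (Chain.t c i))
           (DP.lhs (Chain.dp c (suc i))) (Chain.γ c (suc i))

  argTys : Type → List Type
  argTys (base ι) = []
  argTys (σ ⇒ τ) = σ ∷ argTys τ

  resSort : Type → Sort
  resSort (base ι) = ι
  resSort (σ ⇒ τ) = resSort τ

  _≻ₛ_ : Sort → Sort → Set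
  a ≻ₛ b = (a ≽ₛ b) × ¬ (b ≽ₛ a)

  mutual
    _⪰₊_ : Sort → Type → Set
    ι ⪰₊ base κ = ι ≽ₛ κ
    ι ⪰₊ (σ ⇒ τ) = (ι ≻₋ σ) × (ι ⪰₊ τ)

    _≻₋_ : Sort → Type → Set
    ι ≻₋ base κ = ι ≻ₛ κ
    ι ≻₋ (σ ⇒ τ) = (ι ⪰₊ σ) × (ι ≻₋ τ)

  -- k ∈ Acc(f)  (0-based position)
  AccPos : Fun → ℕ → Set
  AccPos f k = Σ Type λ σ → Nth (argTys (funTy f)) k σ × (resSort (funTy f) ⪰₊ σ)

  TermSet : Set₁
  TermSet = (ι : Sort) → Tm [] (base ι) → Set

  BTerm : Set
  BTerm = Σ Sort (λ ι → Tm [] (base ι))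

  Comp : TermSet → (σ : Type) → Tm [] σ → Set
  Comp I (base ι) s = I ι s
  Comp I (σ ⇒ τ) s = ∀ t → Comp I σ t → Comp I τ (app s t)

  NeutralHead : ∀ {ι} → Tm [] (base ι) → Set
  NeutralHead s = (Σ ℕ λ x → Σ Type λ σ → Σ (TmL []) λ as → AppList s (fvar {σ = σ} x) as)
                ⊎ (Σ Type λ σ → Σ Type λ τ → Σ (Tm (σ ∷ []) τ) λ u → Σ (Σ Type (Tm [])) λ a →
                    Σ (TmL []) λ as → AppList s (lam u) (a ∷ as))

  record IsRC (U : Rules) (I : TermSet) : Set where
    field
      rcTerm    : ∀ {ι s} → I ι s → NoMeta s
      rcSN      : ∀ {ι s} → I ι s → SN U s
      rcClosed  : ∀ {ι s s'} → I ι s → Step U s s' → I ι s'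
      rcNeutral : ∀ {ι} {s : Tm [] (base ι)} → NoMeta s → NeutralHead s
                → (∀ s' → Step U s s' → I ι s') → I ι s

  data AccStep (I : TermSet) : BTerm → BTerm → Set where
    accStep : ∀ {ι κ f as k β ts} {s : Tm [] (base ι)} {s' : Tm [] (base κ)} {u : Tm [] β}
            → AppList s (fun f) as → Nth as k (β , u) → AccPos f k
            → AppList s' u ts → All (λ p → Comp I (proj₁ p) (proj₂ p)) ts
            → AccStep I (ι , s) (κ , s')

  data BStep (U : Rules) (I : TermSet) : BTerm → BTerm → Set where
    bsU : ∀ {ι} {s s' : Tm [] (base ι)} → Step U s s' → BStep U I (ι , s) (ι , s')
    bsA : ∀ {x y} → AccStep I x y → BStep U I x y

  -- the defining equation of C_U
  CSpec : Rules → TermSet → Set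
  CSpec U C = ∀ ι (s : Tm [] (base ι)) →
    (C ι s → CBody ι s) × (CBody ι s → C ι s)
    where
      CBody : (ι : Sort) → Tm [] (base ι) → Set
      CBody ι s = NoMeta s × Acc (λ y x → BStep U C x y) (ι , s)
                × (∀ s' f as k β (u : Tm [] β) → Steps U s s' → AppList s' (fun f) as
                   → Nth as k (β , u) → AccPos f k → Comp C β u)

  UComputable : Rules → TermSet → ∀ {P R} → Chain P R → Set
  UComputable U C {R = R} c =
    (∀ {σ} {s t : Tm [] σ} → NoMeta s → Step R s t → Step U s t)
    × (∀ i (B : List Cond) {τ} (v : Tm [] τ) → DP.rhs (Chain.dp c i) ⊵β[ B ] v
       → Respects (Chain.γ c i) B
       → (xs : List Var) → Unique xs → (∀ x σ → (OccF x σ v → (x , σ) ∈ xs) × ((x , σ) ∈ xs → OccF x σ v))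
       → ∀ {ρ} (w : Tm [] ρ) → AbsOf v xs w → Comp C ρ (msub (Chain.γ c i) w))

  data Mode : Set₁ where
    minimal    : Mode
    arbitrary  : Mode
    computable : Rules → Mode

  data Flag : Set where
    formative : Flag
    all       : Flag

  record DPProblem : Set₁ where
    constructor mkProb
    field
      P    : DP → Set
      R    : Rules
      mode : Mode
      flag : Flag

  ModeOK : (Rules → TermSet) → (m : Mode) → ∀ {P R} → Chain P R → Set
  ModeOK C minimal c = Minimal c
  ModeOK C arbitrary c = ⊤
  ModeOK C (computable U) c = UComputable U (C U) c

  FlagOK : Flag → ∀ {P R} → Chain P R → Set
  FlagOK formative c = Formative c
  FlagOK all c = ⊤

  Finite : (Rules → TermSet) → DPProblem → Set
  Finite C (mkProb P R m f) = ¬ Σ (Chain P R) (λ c → ModeOK C m c × FlagOK f c)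

  Infinite : DPProblem → Set
  Infinite (mkProb P R m f) = NonTerminating R ⊎ Σ (Chain P R) (λ c → ∀ i → Conservative (Chain.dp c i))

  MT : Set
  MT = Σ Type (Tm [])

  ClosedPat : ∀ {σ} → Tm [] σ → Set
  ClosedPat ℓ = Closed ℓ × Pat ℓ

  MetaStable : Rel MT 0ℓ → Set
  MetaStable _R_ = ∀ {σ τ} (ℓ : Tm [] σ) (r : Tm [] τ) → ClosedPat ℓ → (σ , ℓ) R (τ , r)
                 → (γ : MSub) → (σ , msub γ ℓ) R (τ , msub γ r)

  record IsReductionTriple (_≿_ _≽_ _≻_ : Rel MT 0ℓ) : Set where
    field
      ≿-quasi  : IsPreorder _≡_ _≿_
      ≽-quasi  : IsPreorder _≡_ _≽_
      ≻-strict : IsStrictPartialOrder _≡_ _≻_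
      ≻-wf     : WellFounded (λ a b → b ≻ a)
      mono-appL : ∀ {σ τ} {s t : Tm [] (σ ⇒ τ)} (u : Tm [] σ)
                → (σ ⇒ τ , s) ≿ (σ ⇒ τ , t) → (τ , app s u) ≿ (τ , app t u)
      mono-appR : ∀ {σ τ} (u : Tm [] (σ ⇒ τ)) {s t : Tm [] σ}
                → (σ , s) ≿ (σ , t) → (τ , app u s) ≿ (τ , app u t)
      mono-lam  : ∀ {σ τ} {c d : Tm (σ ∷ []) τ} (x : ℕ) → ¬ OccF x σ c → ¬ OccF x σ d
                → (τ , opn c x) ≿ (τ , opn d x) → (σ ⇒ τ , lam c) ≿ (σ ⇒ τ , lam d)
      ≿-stable : MetaStable _≿_
      ≽-stable : MetaStable _≽_
      ≻-stable : MetaStable _≻_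
      beta⊆≿   : ∀ {σ} {s t : Tm [] σ} → BetaStep s t → (σ , s) ≿ (σ , t)
      ≿∘≻⊆≻   : ∀ {x y z} → x ≿ y → y ≻ z → x ≻ z
      ≽∘≻⊆≻   : ∀ {x y z} → x ≽ y → y ≻ z → x ≻ z

-- Each link of a chain t_i →*R s_{i+1} can be oriented by ≿ (rules are ≿-decreasing, ≿ is
-- monotonic and contains β), and each dependency pair step s_i ↦ t_i by ≻ or ≽ (meta-stability).
-- Hence t_i ≻ t_k whenever i < k and the k-th pair comes from P₁, so by well-foundedness of ≻ an
-- infinite chain uses P₁ only finitely often and has a tail that is a chain of P₂ with the same
-- minimality, computability and formativity properties.  Conversely every P₂-chain is a
-- (P₁ ⊎ P₂)-chain.

module Submission where

open import Defs
open import Level using (0ℓ)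
open import Data.Product using (∃-syntax; _×_; _,_; proj₂)
open import Data.Product.Properties using (Σ-≡,≡→≡)
open import Data.Sum using (_⊎_; inj₁; inj₂; [_,_])
open import Data.Empty using (⊥; ⊥-elim)
open import Data.Unit using (tt)
open import Data.Nat using (ℕ; zero; suc; _+_)
open import Data.List using ([]; _∷_)
open import Data.List.Relation.Unary.All using (All; []; _∷_)
open import Data.List.Relation.Unary.All.Properties using (++⁺)
open import Data.List.Relation.Unary.Any using (Any; here; there)
open import Data.List.Relation.Unary.Any.Properties using (++⁺ˡ; ++⁺ʳ)
open import Relation.Nullary using (¬_)
open import Relation.Binary.Core using (Rel)
open import Relation.Binary.Structures using (IsPreorder; IsStrictPartialOrder)
open import Relation.Binary.PropositionalEquality using (_≡_; refl; subst; sym)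
open import Relation.Binary.Construct.Closure.ReflexiveTransitive using (ε; _◅_)
open import Induction.WellFounded using (WellFounded; Acc; acc)

eventually-weak : ∀ {A : Set} {_<_ : Rel A 0ℓ} → WellFounded _<_
  → (x : ℕ → A) (Strict Weak : ℕ → Set) → (∀ i → Strict i ⊎ Weak i)
  → (∀ n d → Strict (suc d + n) → x (suc d + n) < x n)
  → ¬ ¬ (∃[ n ] ∀ j → Weak (suc j + n))
eventually-weak {_<_ = _<_} wf x Strict Weak classify descent noWeakTail = go 0 (wf (x 0))
  where
    go : ∀ n → Acc _<_ (x n) → ⊥
    go n (acc rs) = noWeakTail (n , weak)
      where
        weak : ∀ j → Weak (suc j + n)
        weak j with classify (suc j + n)
        ... | inj₂ w = w
        ... | inj₁ s = ⊥-elim (go (suc j + n) (rs (descent n j s)))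

module MetaFree (Sg : Signature) (_≽ₛ_ : Rel (Signature.Sort Sg) 0ℓ) where
  open Theory Sg _≽ₛ_

  NoMetaArgs : ∀ {Γ σs} → Args Γ σs → Set
  NoMetaArgs ts = ∀ Z → ¬ OccA (IsMV Z) ts

  NoMetaSub : ∀ {Γ Δ} → Sub Γ Δ → Set
  NoMetaSub {Γ} θ = ∀ {σ} (v : Γ ∋ σ) → NoMeta (θ v)

  noMeta-app : ∀ {Γ σ τ} {s : Tm Γ (σ ⇒ τ)} {t} → NoMeta s → NoMeta t → NoMeta (app s t)
  noMeta-app ns nt Z (occHere ())
  noMeta-app ns nt Z (occAppL o) = ns Z o
  noMeta-app ns nt Z (occAppR o) = nt Z o

  noMeta-appˡ : ∀ {Γ σ τ} {s : Tm Γ (σ ⇒ τ)} {t} → NoMeta (app s t) → NoMeta s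
  noMeta-appˡ n Z o = n Z (occAppL o)

  noMeta-appʳ : ∀ {Γ σ τ} {s : Tm Γ (σ ⇒ τ)} {t} → NoMeta (app s t) → NoMeta t
  noMeta-appʳ n Z o = n Z (occAppR o)

  noMeta-lam : ∀ {Γ σ τ} {u : Tm (σ ∷ Γ) τ} → NoMeta u → NoMeta (lam u)
  noMeta-lam nu Z (occHere ())
  noMeta-lam nu Z (occLam o) = nu Z o

  noMeta-lam⁻ : ∀ {Γ σ τ} {u : Tm (σ ∷ Γ) τ} → NoMeta (lam u) → NoMeta u
  noMeta-lam⁻ n Z o = n Z (occLam o)

  noMeta-∷ : ∀ {Γ σ σs} {t : Tm Γ σ} {ts : Args Γ σs} → NoMeta t → NoMetaArgs ts → NoMetaArgs (t ∷ ts)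
  noMeta-∷ nt nts Z (occH o) = nt Z o
  noMeta-∷ nt nts Z (occT o) = nts Z o

  noMeta-head : ∀ {Γ σ σs} {t : Tm Γ σ} {ts : Args Γ σs} → NoMetaArgs (t ∷ ts) → NoMeta t
  noMeta-head n Z o = n Z (occH o)

  noMeta-tail : ∀ {Γ σ σs} {t : Tm Γ σ} {ts : Args Γ σs} → NoMetaArgs (t ∷ ts) → NoMetaArgs ts
  noMeta-tail n Z o = n Z (occT o)

  noMeta-meta : ∀ {Γ σs τ Z} {ts : Args Γ σs} → ¬ NoMeta (meta {τ = τ} Z ts)
  noMeta-meta n = n _ (occHere isMV)

  noMeta-subst : ∀ {Γ ρ ρ'} (eq : ρ ≡ ρ') {t : Tm Γ ρ} → NoMeta t → NoMeta (subst (Tm Γ) eq t)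
  noMeta-subst refl n = n

  mutual
    noMeta-ren : ∀ {Γ Δ σ} (ρ : Ren Γ Δ) (t : Tm Γ σ) → NoMeta t → NoMeta (ren ρ t)
    noMeta-ren ρ (var v) n Z (occHere ())
    noMeta-ren ρ (fvar x) n Z (occHere ())
    noMeta-ren ρ (fun f) n Z (occHere ())
    noMeta-ren ρ (app s t) n =
      noMeta-app (noMeta-ren ρ s (noMeta-appˡ n)) (noMeta-ren ρ t (noMeta-appʳ n))
    noMeta-ren ρ (lam u) n = noMeta-lam (noMeta-ren (liftR ρ) u (noMeta-lam⁻ n))
    noMeta-ren ρ (meta Z ts) n = ⊥-elim (noMeta-meta n)

  mutual
    noMeta-sub : ∀ {Γ Δ σ} {θ : Sub Γ Δ} (t : Tm Γ σ) → NoMeta t → NoMetaSub θ → NoMeta (sub θ t)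
    noMeta-sub (var v) n nθ = nθ v
    noMeta-sub (fvar x) n nθ Z (occHere ())
    noMeta-sub (fun f) n nθ Z (occHere ())
    noMeta-sub (app s t) n nθ =
      noMeta-app (noMeta-sub s (noMeta-appˡ n) nθ) (noMeta-sub t (noMeta-appʳ n) nθ)
    noMeta-sub (lam u) n nθ = noMeta-lam (noMeta-sub u (noMeta-lam⁻ n) (noMeta-liftS nθ))
    noMeta-sub (meta Z ts) n nθ = ⊥-elim (noMeta-meta n)

    noMeta-liftS : ∀ {Γ Δ σ} {θ : Sub Γ Δ} → NoMetaSub θ → NoMetaSub (liftS {σ = σ} θ)
    noMeta-liftS nθ here Z (occHere ())
    noMeta-liftS {θ = θ} nθ (there v) = noMeta-ren there (θ v) (nθ v)

  noMeta-▸ : ∀ {Γ Δ σ} {θ : Sub Γ Δ} {t : Tm Δ σ} → NoMetaSub θ → NoMeta t → NoMetaSub (θ ▸ t)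
  noMeta-▸ nθ nt here = nt
  noMeta-▸ nθ nt (there v) = nθ v

  noMeta-idS▸ : ∀ {σ} {t : Tm [] σ} → NoMeta t → NoMetaSub (idS ▸ t)
  noMeta-idS▸ = noMeta-▸ (λ ())

  noMeta-apps : ∀ {Γ σs τ} (h : Tm Γ (σs ⇛ τ)) (ss : Args Γ σs) → NoMeta h → NoMetaArgs ss
              → NoMeta (apps h ss)
  noMeta-apps h [] nh nss = nh
  noMeta-apps h (s ∷ ss) nh nss =
    noMeta-apps (app h s) ss (noMeta-app nh (noMeta-head nss)) (noMeta-tail nss)

  mutual
    noMeta-instM : ∀ {Δ Γ} σs τ (t : Tm Δ (σs ⇛ τ)) {θ : Sub Δ Γ} (as : Args Γ σs)
                 → NoMeta t → NoMetaSub θ → NoMetaArgs as → NoMeta (instM σs τ t θ as)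
    noMeta-instM [] τ t [] nt nθ nas = noMeta-sub t nt nθ
    noMeta-instM (σ ∷ σs) τ t (s ∷ ss) nt nθ nas = noMeta-instC σs τ t refl s ss nt nθ nas

    noMeta-instC : ∀ {Δ Γ σ ρ} σs τ (t : Tm Δ ρ) (eq : ρ ≡ (σ ⇒ (σs ⇛ τ))) {θ : Sub Δ Γ}
                 (s : Tm Γ σ) (ss : Args Γ σs)
                 → NoMeta t → NoMetaSub θ → NoMetaArgs (s ∷ ss) → NoMeta (instC σs τ t eq θ s ss)
    noMeta-instC σs τ (lam u) refl s ss nt nθ nas =
      noMeta-instM σs τ u ss (noMeta-lam⁻ nt) (noMeta-▸ nθ (noMeta-head nas)) (noMeta-tail nas)
    noMeta-instC σs τ t@(var _) eq s ss = noMeta-rigidInst σs τ t eq s ss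
    noMeta-instC σs τ t@(fvar _) eq s ss = noMeta-rigidInst σs τ t eq s ss
    noMeta-instC σs τ t@(fun _) eq s ss = noMeta-rigidInst σs τ t eq s ss
    noMeta-instC σs τ t@(app _ _) eq s ss = noMeta-rigidInst σs τ t eq s ss
    noMeta-instC σs τ t@(meta _ _) eq s ss = noMeta-rigidInst σs τ t eq s ss

    noMeta-rigidInst : ∀ {Δ Γ σ ρ} σs τ (t : Tm Δ ρ) (eq : ρ ≡ (σ ⇒ (σs ⇛ τ))) {θ : Sub Δ Γ}
                     (s : Tm Γ σ) (ss : Args Γ σs)
                     → NoMeta t → NoMetaSub θ → NoMetaArgs (s ∷ ss)
                     → NoMeta (apps (app (sub θ (subst (Tm Δ) eq t)) s) ss)
    noMeta-rigidInst σs τ t eq s ss nt nθ nas =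
      noMeta-apps _ ss
        (noMeta-app (noMeta-sub _ (noMeta-subst eq nt) nθ) (noMeta-head nas))
        (noMeta-tail nas)

  NoMetaOn : MSub → ∀ {Γ σ} → Tm Γ σ → Set
  NoMetaOn δ t = ∀ {Z σs τ} → OccM (Z , σs , τ) t → NoMeta (δ Z σs τ)

  mutual
    noMeta-msub : ∀ {Γ σ} (δ : MSub) (t : Tm Γ σ) → NoMetaOn δ t → NoMeta (msub δ t)
    noMeta-msub δ (var v) nδ Z (occHere ())
    noMeta-msub δ (fvar x) nδ Z (occHere ())
    noMeta-msub δ (fun f) nδ Z (occHere ())
    noMeta-msub δ (app s t) nδ =
      noMeta-app (noMeta-msub δ s (λ o → nδ (occAppL o))) (noMeta-msub δ t (λ o → nδ (occAppR o)))
    noMeta-msub δ (lam u) nδ = noMeta-lam (noMeta-msub δ u (λ o → nδ (occLam o)))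
    noMeta-msub δ (meta {σs} {τ} Z ts) nδ =
      noMeta-instM σs τ (δ Z σs τ) (msubA δ ts) (nδ (occHere isMV)) (λ ())
        (noMeta-msubA δ ts (λ o → nδ (occMeta o)))

    noMeta-msubA : ∀ {Γ σs} (δ : MSub) (ts : Args Γ σs)
                 → (∀ {Z σs τ} → OccA (IsMV (Z , σs , τ)) ts → NoMeta (δ Z σs τ))
                 → NoMetaArgs (msubA δ ts)
    noMeta-msubA δ [] nδ Z ()
    noMeta-msubA δ (t ∷ ts) nδ =
      noMeta-∷ (noMeta-msub δ t (λ o → nδ (occH o))) (noMeta-msubA δ ts (λ o → nδ (occT o)))

  mutual
    sub-OccM : ∀ {W Γ Δ σ} (θ : Sub Γ Δ) (t : Tm Γ σ) → OccM W t → OccM W (sub θ t)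
    sub-OccM θ (app s t) (occAppL o) = occAppL (sub-OccM θ s o)
    sub-OccM θ (app s t) (occAppR o) = occAppR (sub-OccM θ t o)
    sub-OccM θ (lam u) (occLam o) = occLam (sub-OccM (liftS θ) u o)
    sub-OccM θ (meta Z ts) (occHere isMV) = occHere isMV
    sub-OccM θ (meta Z ts) (occMeta o) = occMeta (subA-OccM θ ts o)

    subA-OccM : ∀ {W Γ Δ σs} (θ : Sub Γ Δ) (ts : Args Γ σs) → OccA (IsMV W) ts
              → OccA (IsMV W) (subA θ ts)
    subA-OccM θ (t ∷ ts) (occH o) = occH (sub-OccM θ t o)
    subA-OccM θ (t ∷ ts) (occT o) = occT (subA-OccM θ ts o)

  apps-OccM : ∀ {W Γ σs τ} (h : Tm Γ (σs ⇛ τ)) (ss : Args Γ σs) → OccM W h → OccM W (apps h ss)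
  apps-OccM h [] o = o
  apps-OccM h (s ∷ ss) o = apps-OccM (app h s) ss (occAppL o)

  mutual
    instM-OccM : ∀ {W Δ Γ} σs τ (t : Tm Δ (σs ⇛ τ)) (θ : Sub Δ Γ) (as : Args Γ σs)
               → OccM W t → OccM W (instM σs τ t θ as)
    instM-OccM [] τ t θ [] o = sub-OccM θ t o
    instM-OccM (σ ∷ σs) τ t θ (s ∷ ss) o = instC-OccM σs τ t refl θ s ss o

    instC-OccM : ∀ {W Δ Γ σ ρ} σs τ (t : Tm Δ ρ) (eq : ρ ≡ (σ ⇒ (σs ⇛ τ))) (θ : Sub Δ Γ)
               (s : Tm Γ σ) (ss : Args Γ σs) → OccM W t → OccM W (instC σs τ t eq θ s ss)
    instC-OccM σs τ (lam u) refl θ s ss (occLam o) = instM-OccM σs τ u (θ ▸ s) ss o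
    instC-OccM σs τ t@(var _) eq θ s ss = rigidInst-OccM σs τ t eq θ s ss
    instC-OccM σs τ t@(fvar _) eq θ s ss = rigidInst-OccM σs τ t eq θ s ss
    instC-OccM σs τ t@(fun _) eq θ s ss = rigidInst-OccM σs τ t eq θ s ss
    instC-OccM σs τ t@(app _ _) eq θ s ss = rigidInst-OccM σs τ t eq θ s ss
    instC-OccM σs τ t@(meta _ _) eq θ s ss = rigidInst-OccM σs τ t eq θ s ss

    rigidInst-OccM : ∀ {W Δ Γ σ ρ} σs τ (t : Tm Δ ρ) (eq : ρ ≡ (σ ⇒ (σs ⇛ τ))) (θ : Sub Δ Γ)
                   (s : Tm Γ σ) (ss : Args Γ σs)
                   → OccM W t → OccM W (apps (app (sub θ (subst (Tm Δ) eq t)) s) ss)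
    rigidInst-OccM σs τ t refl θ s ss o = apps-OccM _ ss (occAppL (sub-OccM θ t o))

  appList-OccM : ∀ {W Γ τ α} {s : Tm Γ τ} {h : Tm Γ α} {as} → AppList s h as → OccM W s
               → OccM W h ⊎ Any (λ a → OccM W (proj₂ a)) as
  appList-OccM alNil o = inj₁ o
  appList-OccM (alSnoc al) (occAppL o) with appList-OccM al o
  ... | inj₁ oh = inj₁ oh
  ... | inj₂ oa = inj₂ (++⁺ˡ oa)
  appList-OccM (alSnoc {as = as} al) (occAppR o) = inj₂ (++⁺ʳ as (here o))

  noMeta-msub-appList : ∀ {Γ τ α} (δ : MSub) {s : Tm Γ τ} {h : Tm Γ α} {as} → AppList s h as
                      → NoMeta (msub δ s) → All (λ a → NoMeta (msub δ (proj₂ a))) as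
  noMeta-msub-appList δ alNil n = []
  noMeta-msub-appList δ (alSnoc al) n =
    ++⁺ (noMeta-msub-appList δ al (noMeta-appˡ n)) (noMeta-appʳ n ∷ [])

  rigidHead-noMeta : ∀ {Γ α} {h : Tm Γ α} → RigidHead h → NoMeta h
  rigidHead-noMeta rhFun Z (occHere ())
  rigidHead-noMeta rhVar Z (occHere ())
  rigidHead-noMeta rhFVar Z (occHere ())

  variables-noMeta : ∀ {Γ σs} {ts : Args Γ σs} → All (λ a → IsVarT (proj₂ a)) (argsToList ts)
                   → NoMetaArgs ts
  variables-noMeta {ts = t ∷ ts} (ivB ∷ vs) Z (occH (occHere ()))
  variables-noMeta {ts = t ∷ ts} (ivF ∷ vs) Z (occH (occHere ()))
  variables-noMeta {ts = t ∷ ts} (v ∷ vs) Z (occT o) = variables-noMeta vs Z o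

  mutual
    pattern-noMetaOn : ∀ {Γ σ} (δ : MSub) {ℓ : Tm Γ σ} → Pat ℓ → NoMeta (msub δ ℓ) → NoMetaOn δ ℓ
    pattern-noMetaOn δ (pMeta (mp {σs} {τ} {Z} {ts} vs _)) n (occHere isMV) W o =
      n W (instM-OccM σs τ (δ Z σs τ) emptyS (msubA δ ts) o)
    pattern-noMetaOn δ (pMeta (mp vs _)) n (occMeta o) = ⊥-elim (variables-noMeta vs _ o)
    pattern-noMetaOn δ (pLam p) n (occLam o) = pattern-noMetaOn δ p (noMeta-lam⁻ n) o
    pattern-noMetaOn δ (pApp al rh ps) n o with appList-OccM al o
    ... | inj₁ oh = ⊥-elim (rigidHead-noMeta rh _ oh)
    ... | inj₂ oa = patterns-noMetaOn δ ps (noMeta-msub-appList δ al n) oa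

    patterns-noMetaOn : ∀ {Γ Z σs τ} (δ : MSub) {as : TmL Γ}
                      → All (λ a → Pat (proj₂ a)) as → All (λ a → NoMeta (msub δ (proj₂ a))) as
                      → Any (λ a → OccM (Z , σs , τ) (proj₂ a)) as → NoMeta (δ Z σs τ)
    patterns-noMetaOn δ (p ∷ ps) (n ∷ ns) (here o) = pattern-noMetaOn δ p n o
    patterns-noMetaOn δ (p ∷ ps) (n ∷ ns) (there oa) = patterns-noMetaOn δ ps ns oa

  noMeta-opn : ∀ {σ τ} {u : Tm (σ ∷ []) τ} (x : ℕ) → NoMeta (lam u) → NoMeta (opn u x)
  noMeta-opn {u = u} x n = noMeta-sub u (noMeta-lam⁻ n) (noMeta-idS▸ (λ Z → λ { (occHere ()) }))

  noMeta-opn⁻ : ∀ {σ τ} {u : Tm (σ ∷ []) τ} (x : ℕ) → NoMeta (opn u x) → NoMeta (lam u)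
  noMeta-opn⁻ {σ} {u = u} x n = noMeta-lam (λ Z o → n Z (sub-OccM (idS ▸ fvar {σ = σ} x) u o))

  rule-noMeta : ∀ {ρ} → WFRule ρ → (δ : MSub)
              → NoMeta (msub δ (Rule.lhs ρ)) → NoMeta (msub δ (Rule.rhs ρ))
  rule-noMeta {ρ} (_ , (lhsPat , _) , _ , rhsMVars⊆lhsMVars) δ n =
    noMeta-msub δ (Rule.rhs ρ) (λ o → pattern-noMetaOn δ lhsPat n (rhsMVars⊆lhsMVars _ o))

  step-noMeta : ∀ {R σ} {s s' : Tm [] σ} → WFRules R → Step R s s' → NoMeta s → NoMeta s'
  step-noMeta wfR (root r δ) = rule-noMeta (wfR _ r) δ
  step-noMeta wfR (beta {u = u}) n =
    noMeta-sub u (noMeta-lam⁻ (noMeta-appˡ n)) (noMeta-idS▸ (noMeta-appʳ n))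
  step-noMeta wfR (appL st) n = noMeta-app (step-noMeta wfR st (noMeta-appˡ n)) (noMeta-appʳ n)
  step-noMeta wfR (appR st) n = noMeta-app (noMeta-appˡ n) (step-noMeta wfR st (noMeta-appʳ n))
  step-noMeta wfR (abs x _ _ st) n = noMeta-opn⁻ x (step-noMeta wfR st (noMeta-opn x n))
  step-noMeta wfR (metaA _) n = ⊥-elim (noMeta-meta n)

module Chains (Sg : Signature) (_≽ₛ_ : Rel (Signature.Sort Sg) 0ℓ) where
  open Theory Sg _≽ₛ_

  chain-mono : ∀ {P Q R} → (∀ d → P d → Q d) → Chain P R → Chain Q R
  chain-mono P⊆Q c = record
    { dp = dp ; inP = λ i → P⊆Q (dp i) (inP i) ; s = s ; t = t ; γ = γ
    ; sTerm = sTerm ; tTerm = tTerm ; resp = resp ; sEq = sEq ; tEq = tEq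
    ; tyEq = tyEq ; link = link }
    where open Chain c

  chain-after : ∀ {P Q R} (c : Chain P R) (n : ℕ) → (∀ j → Q (Chain.dp c (suc j + n))) → Chain Q R
  chain-after c n inQ = record
    { dp = λ j → dp (suc j + n) ; inP = inQ
    ; s = λ j → s (suc j + n) ; t = λ j → t (suc j + n) ; γ = λ j → γ (suc j + n)
    ; sTerm = λ j → sTerm (suc j + n) ; tTerm = λ j → tTerm (suc j + n)
    ; resp = λ j → resp (suc j + n) ; sEq = λ j → sEq (suc j + n) ; tEq = λ j → tEq (suc j + n)
    ; tyEq = λ j → tyEq (suc j + n) ; link = λ j → link (suc j + n) }
    where open Chain c

  modeOK-after : ∀ {P Q R} (C : Rules → TermSet) (m : Mode) (c : Chain P R) n
                 (inQ : ∀ j → Q (Chain.dp c (suc j + n)))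
               → ModeOK C m c → ModeOK C m (chain-after {Q = Q} c n inQ)
  modeOK-after C minimal c n inQ min = λ j → min (suc j + n)
  modeOK-after C arbitrary c n inQ _ = tt
  modeOK-after C (computable U) c n inQ (R⊆U , comp) = R⊆U , λ j → comp (suc j + n)

  flagOK-after : ∀ {P Q R} (f : Flag) (c : Chain P R) n (inQ : ∀ j → Q (Chain.dp c (suc j + n)))
               → FlagOK f c → FlagOK f (chain-after {Q = Q} c n inQ)
  flagOK-after formative c n inQ form = λ j → form (suc j + n)
  flagOK-after all c n inQ _ = tt

module Orientation (Sg : Signature) (_≽ₛ_ : Rel (Signature.Sort Sg) 0ℓ)
                   (_≿_ _≽_ _≻_ : Rel (Theory.MT Sg _≽ₛ_) 0ℓ)
                   (RT : Theory.IsReductionTriple Sg _≽ₛ_ _≿_ _≽_ _≻_) where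
  open Theory Sg _≽ₛ_
  open MetaFree Sg _≽ₛ_
  open IsReductionTriple RT
  private module ≿ = IsPreorder ≿-quasi

  descent : (S T : ℕ → MT) → (∀ i → T i ≿ S (suc i)) → (∀ i → S i ≻ T i ⊎ S i ≽ T i)
          → ∀ d → S (suc d) ≻ T (suc d) → T 0 ≻ T (suc d)
  descent S T linked oriented zero S≻T = ≿∘≻⊆≻ (linked 0) S≻T
  descent S T linked oriented (suc d) S≻T =
    ≿∘≻⊆≻ (linked 0) (via (oriented 1) (descent (λ i → S (suc i)) (λ i → T (suc i))
                                           (λ i → linked (suc i)) (λ i → oriented (suc i)) d S≻T))
    where
      via : ∀ {x} → S 1 ≻ T 1 ⊎ S 1 ≽ T 1 → T 1 ≻ x → S 1 ≻ x
      via (inj₁ S≻T₁) = IsStrictPartialOrder.trans ≻-strict S≻T₁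
      via (inj₂ S≽T₁) = ≽∘≻⊆≻ S≽T₁

  module _ {R : Rules} (wfR : WFRules R)
           (R⊆≿ : ∀ ρ → R ρ → (Rule.rty ρ , Rule.lhs ρ) ≿ (Rule.rty ρ , Rule.rhs ρ)) where

    -- Monotonicity of ≿ says nothing about steps inside meta-variable arguments; that is why
    -- reductions are oriented only from meta-free terms, which step-noMeta shows to be preserved.
    step⇒≿ : ∀ {σ} {s s' : Tm [] σ} → Step R s s' → NoMeta s → (σ , s) ≿ (σ , s')
    step⇒≿ (root {ρ} r δ) _ with wfR ρ r
    ... | lhsClosed , (lhsPat , _) , _ = ≿-stable (Rule.lhs ρ) (Rule.rhs ρ) (lhsClosed , lhsPat) (R⊆≿ ρ r) δ
    step⇒≿ beta _ = beta⊆≿ beta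
    step⇒≿ (appL {t = t} st) n = mono-appL t (step⇒≿ st (noMeta-appˡ n))
    step⇒≿ (appR {s = s} st) n = mono-appR s (step⇒≿ st (noMeta-appʳ n))
    step⇒≿ (abs x x∉u x∉u' st) n =
      mono-lam x (λ o → x∉u (occLam o)) (λ o → x∉u' (occLam o)) (step⇒≿ st (noMeta-opn x n))
    step⇒≿ (metaA _) n = ⊥-elim (noMeta-meta n)

    steps⇒≿ : ∀ {σ} {s s' : Tm [] σ} → Steps R s s' → NoMeta s → (σ , s) ≿ (σ , s')
    steps⇒≿ ε _ = ≿.refl
    steps⇒≿ (st ◅ sts) n = ≿.trans (step⇒≿ st n) (steps⇒≿ sts (step-noMeta wfR st n))

    link⇒≿ : ∀ {σ} {t s : Tm [] σ} → Link R t s → NoMeta t → (σ , t) ≿ (σ , s)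
    link⇒≿ lkHead _ = ≿.refl
    link⇒≿ (lkApp {s = s} {u = u} l sts) n =
      ≿.trans (mono-appL u (link⇒≿ l (noMeta-appˡ n))) (mono-appR s (steps⇒≿ sts (noMeta-appʳ n)))

    module _ {P₁ P₂ : DP → Set} (P⊆DP : ∀ d → P₁ d ⊎ P₂ d → IsDP d)
             (P₁⊆≻ : ∀ d → P₁ d → (DP.lty d , DP.lhs d) ≻ (DP.rty d , DP.rhs d))
             (P₂⊆≽ : ∀ d → P₂ d → (DP.lty d , DP.lhs d) ≽ (DP.rty d , DP.rhs d))
             (c : Chain (λ d → P₁ d ⊎ P₂ d) R) where
      open Chain c

      S T : ℕ → MT
      S i = DP.lty (dp i) , s i
      T i = DP.rty (dp i) , t i

      T-linked : ∀ i → T i ≿ S (suc i)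
      T-linked i = subst (_≿ S (suc i)) (sym (Σ-≡,≡→≡ (tyEq i , refl)))
                         (link⇒≿ (link i) (noMeta-subst (tyEq i) (tTerm i)))

      dpClosedPat : ∀ i → ClosedPat (DP.lhs (dp i))
      dpClosedPat i with P⊆DP (dp i) (inP i)
      ... | (lhsClosed , lhsPat , _) , _ = lhsClosed , lhsPat

      S≻T : ∀ i → P₁ (dp i) → S i ≻ T i
      S≻T i p rewrite sEq i | tEq i =
        ≻-stable (DP.lhs (dp i)) (DP.rhs (dp i)) (dpClosedPat i) (P₁⊆≻ (dp i) p) (γ i)

      S≽T : ∀ i → P₂ (dp i) → S i ≽ T i
      S≽T i p rewrite sEq i | tEq i =
        ≽-stable (DP.lhs (dp i)) (DP.rhs (dp i)) (dpClosedPat i) (P₂⊆≽ (dp i) p) (γ i)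

      S-oriented : ∀ i → S i ≻ T i ⊎ S i ≽ T i
      S-oriented i with inP i
      ... | inj₁ p = inj₁ (S≻T i p)
      ... | inj₂ p = inj₂ (S≽T i p)

      T-descends : ∀ n d → P₁ (dp (suc d + n)) → T n ≻ T (suc d + n)
      T-descends n d p =
        descent (λ j → S (j + n)) (λ j → T (j + n)) (λ j → T-linked (j + n))
                (λ j → S-oriented (j + n)) d (S≻T (suc d + n) p)

      eventually-P₂ : ¬ ¬ (∃[ n ] ∀ j → P₂ (dp (suc j + n)))
      eventually-P₂ = eventually-weak ≻-wf T (λ i → P₁ (dp i)) (λ i → P₂ (dp i)) inP T-descends

theorem49 : (Sg : Signature) (_≽ₛ_ : Rel (Signature.Sort Sg) 0ℓ)
    → IsPreorder _≡_ _≽ₛ_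
    → WellFounded (λ a b → Theory._≻ₛ_ Sg _≽ₛ_ b a)
    → let open Theory Sg _≽ₛ_ in
      (C : Rules → TermSet) → (∀ U → IsRC U (C U) × CSpec U (C U))
    → (P₁ P₂ : DP → Set) (R : Rules) (m : Mode) (f : Flag)
    → WFRules R → FreshSymbols R
    → (∀ d → P₁ d → IsDP d) → (∀ d → P₂ d → IsDP d)
    → (∀ d → P₁ d → P₂ d → ⊥)
    → (_≿_ _≽_ _≻_ : Rel MT 0ℓ) → IsReductionTriple _≿_ _≽_ _≻_
    → (∀ ρ → R ρ → (Rule.rty ρ , Rule.lhs ρ) ≿ (Rule.rty ρ , Rule.rhs ρ))
    → (∀ d → P₁ d → (DP.lty d , DP.lhs d) ≻ (DP.rty d , DP.rhs d))
    → (∀ d → P₂ d → (DP.lty d , DP.lhs d) ≽ (DP.rty d , DP.rhs d))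
    → (Finite C (mkProb P₂ R m f) → Finite C (mkProb (λ d → P₁ d ⊎ P₂ d) R m f))
      × (Infinite (mkProb P₂ R m f) → Infinite (mkProb (λ d → P₁ d ⊎ P₂ d) R m f))
theorem49 Sg _≽ₛ_ _ _ C _ P₁ P₂ R m f wfR _ P₁⊆DP P₂⊆DP _ _≿_ _≽_ _≻_ RT R⊆≿ P₁⊆≻ P₂⊆≽ =
  sound , complete
  where
    open Theory Sg _≽ₛ_
    open Chains Sg _≽ₛ_
    open Orientation Sg _≽ₛ_ _≿_ _≽_ _≻_ RT

    sound : Finite C (mkProb P₂ R m f) → Finite C (mkProb (λ d → P₁ d ⊎ P₂ d) R m f)
    sound finite₂ (c , modeOK , flagOK) =
      eventually-P₂ wfR R⊆≿ (λ d → [ P₁⊆DP d , P₂⊆DP d ]) P₁⊆≻ P₂⊆≽ c λ (n , inP₂) →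
        finite₂ ( chain-after c n inP₂
                , modeOK-after C m c n inP₂ modeOK
                , flagOK-after f c n inP₂ flagOK )

    complete : Infinite (mkProb P₂ R m f) → Infinite (mkProb (λ d → P₁ d ⊎ P₂ d) R m f)
    complete (inj₁ nonTerminating) = inj₁ nonTerminating
    complete (inj₂ (c , conservative)) = inj₂ (chain-mono (λ _ → inj₂) c , conservative)
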